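{- Let $f=\min_<$ where $<$ is a regular $\neg$-decreasing total ordering of $Sen(L)$. Then for every truth assignment $M$ and all $\varphi,\psi,\sigma\in Sen(L_s)$, $$\langle M,f\rangle\models_s\varphi\circ(\psi|\sigma)\leftrightarrow(\varphi\circ\psi)|(\varphi\circ\sigma)$$ and $$\langle M,f\rangle\models_s\varphi|(\psi\circ\sigma)\leftrightarrow(\varphi|\psi)\circ(\varphi|\sigma).$$
   Context: $L$ is the propositional language with atoms $p_0,p_1,\ldots$ and connectives $\neg,\wedge$ (others defined); $L_s$ adds a primitive binary connective $|$, and $\varphi\circ\psi$ abbreviates $\neg(\neg\varphi|\neg\psi)$. $\sim$ is classical equivalence on $Sen(L)$, $[\alpha]=\{\beta:\beta\sim\alpha\}$. A total ordering $<$ of $Sen(L)$ is regular if $\alpha\not\sim\beta$ and $\alpha<\beta$ imply $\alpha'<\beta'$ for all $\alpha'\in[\alpha],\beta'\in[\beta]$; it is $\neg$-decreasing if for all $\alpha\not\sim\beta$: $\alpha<\beta\iff\neg\beta<\neg\alpha$. $\min_<(\alpha,\beta)$ is the $<$-least of $\alpha,\beta$. A choice function $f$ for $L$ induces $\overline f:Sen(L_s)\to Sen(L)$: identity on $Sen(L)$, commuting with $\neg,\wedge$, and $\overline f(\varphi|\psi)=f(\overline f(\varphi),\overline f(\psi))$. For a truth assignment $M$, $\langle M,f\rangle\models_s\varphi$ iff $M\models\overline f(\varphi)$. -}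

module Defs where

open import Level using (0ℓ)
open import Data.Nat using (ℕ)
open import Data.Bool using (Bool; true; false; not; _∧_)
open import Data.Product using (_×_)
open import Relation.Nullary using (¬_)
open import Relation.Binary.Core using (Rel)
open import Relation.Binary.Definitions using (Trichotomous; tri<; tri≈; tri>)
open import Relation.Binary.Structures using (IsStrictTotalOrder)
open import Relation.Binary.PropositionalEquality using (_≡_)

data Sen : Set where
  atom : ℕ → Sen
  neg  : Sen → Sen
  conj : Sen → Sen → Sen

data SenS : Set where
  atom : ℕ → SenS
  neg  : SenS → SenS
  conj : SenS → SenS → SenS
  bar  : SenS → SenS → SenS

Assignment : Set
Assignment = ℕ → Bool

eval : Assignment → Sen → Bool
eval M (atom i)   = M i
eval M (neg α)    = not (eval M α)
eval M (conj α β) = eval M α ∧ eval M β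

_⊨_ : Assignment → Sen → Set
M ⊨ α = eval M α ≡ true

_∼_ : Sen → Sen → Set
α ∼ β = ∀ (M : Assignment) → eval M α ≡ eval M β

Regular : Rel Sen 0ℓ → Set
Regular _<_ = ∀ {α β α' β'} → ¬ (α ∼ β) → α < β → α' ∼ α → β' ∼ β → α' < β'

NegDecreasing : Rel Sen 0ℓ → Set
NegDecreasing _<_ = ∀ {α β} → ¬ (α ∼ β) → (α < β → neg β < neg α) × (neg β < neg α → α < β)

minBy : {_<_ : Rel Sen 0ℓ} → IsStrictTotalOrder _≡_ _<_ → Sen → Sen → Sen
minBy sto α β with IsStrictTotalOrder.compare sto α β
... | tri< _ _ _ = α
... | tri≈ _ _ _ = α
... | tri> _ _ _ = β

bar-f : (Sen → Sen → Sen) → SenS → Sen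
bar-f f (atom i)   = atom i
bar-f f (neg φ)    = neg (bar-f f φ)
bar-f f (conj φ ψ) = conj (bar-f f φ) (bar-f f ψ)
bar-f f (bar φ ψ)  = f (bar-f f φ) (bar-f f ψ)

⟨_,_⟩⊨s_ : Assignment → (Sen → Sen → Sen) → SenS → Set
⟨ M , f ⟩⊨s φ = M ⊨ bar-f f φ

_∘_ : SenS → SenS → SenS
φ ∘ ψ = neg (bar (neg φ) (neg ψ))

_⇒_ : SenS → SenS → SenS
φ ⇒ ψ = neg (conj φ (neg ψ))

_⇔_ : SenS → SenS → SenS
φ ⇔ ψ = conj (φ ⇒ ψ) (ψ ⇒ φ)

{-# OPTIONS --safe #-}
-- On a chain, max distributes over min and vice versa.  A ¬-decreasing order
-- makes the translation ¬ min(¬ a, ¬ b) of φ ∘ ψ equivalent to max(a, b), and a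
-- regular order makes min a congruence for classical equivalence; so the two laws
-- are the two distributive laws of the chain, read up to equivalence.
module Submission where

open import Defs
open import Level using (0ℓ)
open import Data.Bool using (true; false)
open import Data.Bool.Properties using (not-involutive) renaming (_≟_ to _≟ᵇ_)
open import Data.Product using (_×_; _,_; proj₁)
open import Data.Sum using (inj₁; inj₂)
open import Relation.Nullary using (¬_; contradiction)
open import Relation.Nullary.Negation.Core using (Stable)
open import Relation.Nullary.Decidable using (decidable-stable)
open import Relation.Binary.Core using (Rel)
open import Relation.Binary.Bundles using (Setoid; StrictTotalOrder)
open import Relation.Binary.Definitions using (tri<; tri≈; tri>)
open import Relation.Binary.Structures using (IsStrictTotalOrder)
open import Relation.Binary.PropositionalEquality using (_≡_; refl; sym; trans; cong)
open import Algebra.Construct.NaturalChoice.Base using (MinOperator)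
import Algebra.Construct.NaturalChoice.Max as Max
import Algebra.Construct.NaturalChoice.MinMaxOp as MinMaxOp
import Relation.Binary.Properties.StrictTotalOrder as StrictTotalOrderProperties
import Relation.Binary.Reasoning.Setoid as SetoidReasoning

∼-refl : ∀ {α} → α ∼ α
∼-refl _ = refl

∼-sym : ∀ {α β} → α ∼ β → β ∼ α
∼-sym α∼β M = sym (α∼β M)

∼-trans : ∀ {α β γ} → α ∼ β → β ∼ γ → α ∼ γ
∼-trans α∼β β∼γ M = trans (α∼β M) (β∼γ M)

-- _∼_ unfolds to a Π-type, so its arguments cannot be inferred from a proof of
-- it; this is why they are given explicitly here and in a few places below.
∼-setoid : Setoid 0ℓ 0ℓ
∼-setoid = record
  { Carrier       = Sen
  ; _≈_           = _∼_
  ; isEquivalence = record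
    { refl  = λ {α} → ∼-refl {α}
    ; sym   = λ {α β} → ∼-sym {α} {β}
    ; trans = λ {α β γ} → ∼-trans {α} {β} {γ}
    }
  }

open SetoidReasoning ∼-setoid

-- Each instance of _∼_ is a family of Boolean equalities, hence stable.
∼-stable : ∀ {α β} → Stable (α ∼ β)
∼-stable {α} {β} ¬¬α∼β M =
  decidable-stable (eval M α ≟ᵇ eval M β) (λ α≉β → ¬¬α∼β (λ α∼β → α≉β (α∼β M)))

neg-involutive : ∀ α → neg (neg α) ∼ α
neg-involutive α M = not-involutive (eval M α)

⊨s-⇔ : ∀ {M f} φ ψ → eval M (bar-f f φ) ≡ eval M (bar-f f ψ) → ⟨ M , f ⟩⊨s (φ ⇔ ψ)
⊨s-⇔ {M} {f} φ ψ _ with eval M (bar-f f φ) | eval M (bar-f f ψ)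
⊨s-⇔ _ _ _  | false | false = refl
⊨s-⇔ _ _ _  | true  | true  = refl
⊨s-⇔ _ _ () | false | true
⊨s-⇔ _ _ () | true  | false

module MinChoice {_<_ : Rel Sen 0ℓ} (sto : IsStrictTotalOrder _≡_ _<_) where

  strictTotalOrder : StrictTotalOrder 0ℓ 0ℓ 0ℓ
  strictTotalOrder = record { isStrictTotalOrder = sto }

  open IsStrictTotalOrder sto using (compare; irrefl; asym)
  open StrictTotalOrderProperties strictTotalOrder
    using (totalOrder; totalPreorder; _≤_; total)

  infixl 7 _⊓_
  _⊓_ : Sen → Sen → Sen
  _⊓_ = minBy sto

  -- the translation of φ ∘ ψ
  infixl 6 _⊚_
  _⊚_ : Sen → Sen → Sen
  α ⊚ β = neg (neg α ⊓ neg β)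

  x≤y⇒x⊓y≡x : ∀ {x y} → x ≤ y → x ⊓ y ≡ x
  x≤y⇒x⊓y≡x {x} {y} _ with compare x y
  x≤y⇒x⊓y≡x _          | tri< _ _ _   = refl
  x≤y⇒x⊓y≡x _          | tri≈ _ _ _   = refl
  x≤y⇒x⊓y≡x (inj₁ x<y) | tri> _ _ y<x = contradiction y<x (asym x<y)
  x≤y⇒x⊓y≡x (inj₂ x≡y) | tri> _ _ _   = sym x≡y

  x≥y⇒x⊓y≡y : ∀ {x y} → y ≤ x → x ⊓ y ≡ y
  x≥y⇒x⊓y≡y {x} {y} _ with compare x y
  x≥y⇒x⊓y≡y _          | tri> _ _ _   = refl
  x≥y⇒x⊓y≡y _          | tri≈ _ x≡y _ = x≡y
  x≥y⇒x⊓y≡y (inj₁ y<x) | tri< x<y _ _ = contradiction y<x (asym x<y)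
  x≥y⇒x⊓y≡y (inj₂ y≡x) | tri< _ _ _   = sym y≡x

  minOperator : MinOperator totalPreorder
  minOperator = record
    { _⊓_       = _⊓_
    ; x≤y⇒x⊓y≈x = x≤y⇒x⊓y≡x
    ; x≥y⇒x⊓y≈y = x≥y⇒x⊓y≡y
    }

  open Max totalOrder using (_⊔_; maxOperator; x≤y⇒x⊔y≈y; x≤y⇒y⊔x≈y)
  open MinMaxOp minOperator maxOperator
    using (⊓-comm; ⊓-sel; ⊓-distribˡ-⊔; ⊔-distribˡ-⊓)

  ≤∧≁⇒< : ∀ {x y} → x ≤ y → ¬ (x ∼ y) → x < y
  ≤∧≁⇒< (inj₁ x<y)  _   = x<y
  ≤∧≁⇒< {x} (inj₂ refl) x≁x = contradiction (∼-refl {x}) x≁x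

  ⊚-≤ : NegDecreasing _<_ → ∀ {x y} → x ≤ y → (x ⊚ y) ∼ y
  ⊚-≤ negDec {x} {y} x≤y with ⊓-sel (neg x) (neg y)
  ... | inj₂ ⊓≡¬y = begin
    x ⊚ y        ≡⟨ cong neg ⊓≡¬y ⟩
    neg (neg y)  ≈⟨ neg-involutive y ⟩
    y            ∎
  ... | inj₁ ⊓≡¬x = begin
    x ⊚ y        ≡⟨ cong neg ⊓≡¬x ⟩
    neg (neg x)  ≈⟨ neg-involutive x ⟩
    x            ≈⟨ ∼-stable {x} {y} x≁y-impossible ⟩
    y            ∎
    where
    -- if x and y were inequivalent, ¬ y < ¬ x and min would have picked ¬ y
    x≁y-impossible : ¬ ¬ (x ∼ y)
    x≁y-impossible x≁y = irrefl (trans (sym (x≥y⇒x⊓y≡y (inj₁ ¬y<¬x))) ⊓≡¬x) ¬y<¬x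
      where
      ¬y<¬x : neg y < neg x
      ¬y<¬x = proj₁ (negDec {x} {y} x≁y) (≤∧≁⇒< x≤y x≁y)

  ⊚∼⊔ : NegDecreasing _<_ → ∀ x y → (x ⊚ y) ∼ (x ⊔ y)
  ⊚∼⊔ negDec x y with total x y
  ... | inj₁ x≤y = begin
    x ⊚ y  ≈⟨ ⊚-≤ negDec x≤y ⟩
    y      ≡⟨ x≤y⇒x⊔y≈y x≤y ⟨
    x ⊔ y  ∎
  ... | inj₂ y≤x = begin
    x ⊚ y  ≡⟨ cong neg (⊓-comm (neg x) (neg y)) ⟩
    y ⊚ x  ≈⟨ ⊚-≤ negDec y≤x ⟩
    x      ≡⟨ x≤y⇒y⊔x≈y y≤x ⟨
    x ⊔ y  ∎

  ⊓-cong-∼-≤ : Regular _<_ → ∀ {x y x′ y′} → x ≤ y → x ∼ x′ → y ∼ y′ →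
               (x ⊓ y) ∼ (x′ ⊓ y′)
  ⊓-cong-∼-≤ regular {x} {y} {x′} {y′} x≤y x∼x′ y∼y′ with ⊓-sel x′ y′
  ... | inj₁ ⊓≡x′ = begin
    x ⊓ y    ≡⟨ x≤y⇒x⊓y≡x x≤y ⟩
    x        ≈⟨ x∼x′ ⟩
    x′       ≡⟨ ⊓≡x′ ⟨
    x′ ⊓ y′  ∎
  ... | inj₂ ⊓≡y′ = begin
    x ⊓ y    ≡⟨ x≤y⇒x⊓y≡x x≤y ⟩
    x        ≈⟨ ∼-stable {x} {y} x≁y-impossible ⟩
    y        ≈⟨ y∼y′ ⟩
    y′       ≡⟨ ⊓≡y′ ⟨
    x′ ⊓ y′  ∎
    where
    -- if x and y were inequivalent, x′ < y′ and min would have picked x′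
    x≁y-impossible : ¬ ¬ (x ∼ y)
    x≁y-impossible x≁y = irrefl (trans (sym (x≤y⇒x⊓y≡x (inj₁ x′<y′))) ⊓≡y′) x′<y′
      where
      x′<y′ : x′ < y′
      x′<y′ = regular {x} {y} x≁y (≤∧≁⇒< x≤y x≁y) (∼-sym {x} {x′} x∼x′) (∼-sym {y} {y′} y∼y′)

  ⊓-cong-∼ : Regular _<_ → ∀ {x y x′ y′} → x ∼ x′ → y ∼ y′ → (x ⊓ y) ∼ (x′ ⊓ y′)
  ⊓-cong-∼ regular {x} {y} {x′} {y′} x∼x′ y∼y′ with total x y
  ... | inj₁ x≤y = ⊓-cong-∼-≤ regular x≤y x∼x′ y∼y′
  ... | inj₂ y≤x = begin
    x ⊓ y    ≡⟨ ⊓-comm x y ⟩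
    y ⊓ x    ≈⟨ ⊓-cong-∼-≤ regular y≤x y∼y′ x∼x′ ⟩
    y′ ⊓ x′  ≡⟨ ⊓-comm y′ x′ ⟩
    x′ ⊓ y′  ∎

  ⊚-distribˡ-⊓ : Regular _<_ → NegDecreasing _<_ →
                 ∀ x y z → (x ⊚ (y ⊓ z)) ∼ ((x ⊚ y) ⊓ (x ⊚ z))
  ⊚-distribˡ-⊓ regular negDec x y z = begin
    x ⊚ (y ⊓ z)            ≈⟨ ⊚∼⊔ negDec x (y ⊓ z) ⟩
    x ⊔ (y ⊓ z)            ≡⟨ ⊔-distribˡ-⊓ x y z ⟩
    (x ⊔ y) ⊓ (x ⊔ z)      ≈⟨ ⊓-cong-∼ regular (⊚∼⊔ negDec x y) (⊚∼⊔ negDec x z) ⟨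
    (x ⊚ y) ⊓ (x ⊚ z)      ∎

  ⊓-distribˡ-⊚ : Regular _<_ → NegDecreasing _<_ →
                 ∀ x y z → (x ⊓ (y ⊚ z)) ∼ ((x ⊓ y) ⊚ (x ⊓ z))
  ⊓-distribˡ-⊚ regular negDec x y z = begin
    x ⊓ (y ⊚ z)            ≈⟨ ⊓-cong-∼ regular (∼-refl {x}) (⊚∼⊔ negDec y z) ⟩
    x ⊓ (y ⊔ z)            ≡⟨ ⊓-distribˡ-⊔ x y z ⟩
    (x ⊓ y) ⊔ (x ⊓ z)      ≈⟨ ⊚∼⊔ negDec (x ⊓ y) (x ⊓ z) ⟨
    (x ⊓ y) ⊚ (x ⊓ z)      ∎

proposition2p46 : (_<_ : Rel Sen 0ℓ) (sto : IsStrictTotalOrder _≡_ _<_) →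
    Regular _<_ → NegDecreasing _<_ →
    ∀ (M : Assignment) (φ ψ σ : SenS) →
      (⟨ M , minBy sto ⟩⊨s ((φ ∘ bar ψ σ) ⇔ bar (φ ∘ ψ) (φ ∘ σ)))
      × (⟨ M , minBy sto ⟩⊨s (bar φ (ψ ∘ σ) ⇔ ((bar φ ψ) ∘ (bar φ σ))))
proposition2p46 _<_ sto regular negDec M φ ψ σ =
    ⊨s-⇔ {M} {_⊓_} (φ ∘ bar ψ σ) (bar (φ ∘ ψ) (φ ∘ σ)) (⊚-distribˡ-⊓ regular negDec a b c M)
  , ⊨s-⇔ {M} {_⊓_} (bar φ (ψ ∘ σ)) (bar φ ψ ∘ bar φ σ) (⊓-distribˡ-⊚ regular negDec a b c M)
  where
  open MinChoice sto
  a = bar-f _⊓_ φ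
  b = bar-f _⊓_ ψ
  c = bar-f _⊓_ σ
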